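{- Let $\Omega$ be a set with $|\Omega|=5$ and let $\mathcal{H}$ be a domination completion of $\mathcal{U}_{3,\Omega}$. Then there exists a graph $G\in\mathcal{C}_5\cup\mathcal{K}_{2,3}$ such that $\mathcal{U}_{3,\Omega}\leqslant\mathcal{D}(G)\leqslant\mathcal{H}$.
   Context: Graphs are finite, simple, undirected; $\mathcal{D}(G)$ is the family of inclusion-minimal dominating sets of $G$ (a dominating set is $D\subseteq V(G)$ such that every vertex outside $D$ has a neighbour in $D$). $\mathcal{C}_5$ is the family of graphs with vertex set $\Omega$ isomorphic to the cycle $C_5$; $\mathcal{K}_{2,3}$ is the family of graphs with vertex set $\Omega$ isomorphic to $K_{2,3}$. A hypergraph on $\Omega$ is a nonempty family of nonempty subsets of $\Omega$, none a proper subset of another; it has ground set $\Omega$ if the union of its members is $\Omega$. A domination hypergraph is one of the form $\mathcal{D}(G)$. $\mathcal{U}_{3,\Omega}=\{A\subseteq\Omega:|A|=3\}$. $\mathcal{H}_1\leqslant\mathcal{H}_2$ means: for every $A_1\in\mathcal{H}_1$ there is $A_2\in\mathcal{H}_2$ with $A_2\subseteq A_1$. A domination completion of $\mathcal{U}_{3,\Omega}$ is a domination hypergraph $\mathcal{H}$ with ground set $\Omega$ and $\mathcal{U}_{3,\Omega}\leqslant\mathcal{H}$. -}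

module Defs where

open import Data.Nat using (ℕ; suc; _+_; _≡ᵇ_; _<ᵇ_; _%_)
open import Data.Bool using (Bool; true; false; _∨_; _xor_)
open import Data.Fin using (Fin; toℕ)
open import Data.Fin.Subset using (Subset; _∈_; _∉_; _⊆_; _⊂_; ∣_∣)
open import Data.Fin.Permutation using (Permutation′; _⟨$⟩ʳ_)
open import Data.Product using (Σ; ∃; ∃-syntax; _×_)
open import Data.Sum using (_⊎_)
open import Relation.Nullary using (¬_)
open import Relation.Binary.PropositionalEquality using (_≡_)
open import Function.Bundles using (_⇔_)

record Graph (n : ℕ) : Set where
  field
    adj     : Fin n → Fin n → Bool
    adj-sym : ∀ i j → adj i j ≡ adj j i
    adj-irr : ∀ i → adj i i ≡ false
open Graph public

Dominating : ∀ {n} → Graph n → Subset n → Set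
Dominating G D = ∀ v → v ∉ D → ∃[ u ] (u ∈ D × adj G u v ≡ true)

MinDom : ∀ {n} → Graph n → Subset n → Set
MinDom G D = Dominating G D × (∀ D′ → D′ ⊂ D → ¬ Dominating G D′)

Family : ℕ → Set₁
Family n = Subset n → Set

_≤ᴴ_ : ∀ {n} → Family n → Family n → Set
H₁ ≤ᴴ H₂ = ∀ A → H₁ A → ∃[ B ] (H₂ B × B ⊆ A)

HasGroundSet : ∀ {n} → Family n → Set
HasGroundSet H = ∀ v → ∃[ A ] (H A × v ∈ A)

IsDominationHypergraph : ∀ {n} → Family n → Set
IsDominationHypergraph H = ∃[ G ] (∀ A → H A ⇔ MinDom G A)

U3 : ∀ {n} → Family n
U3 A = ∣ A ∣ ≡ 3

IsDominationCompletionU3 : ∀ {n} → Family n → Set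
IsDominationCompletionU3 H =
  IsDominationHypergraph H × HasGroundSet H × (U3 ≤ᴴ H)

c5adj : Fin 5 → Fin 5 → Bool
c5adj i j = ((suc (toℕ i) % 5) ≡ᵇ toℕ j) ∨ ((suc (toℕ j) % 5) ≡ᵇ toℕ i)

k23adj : Fin 5 → Fin 5 → Bool
k23adj i j = (toℕ i <ᵇ 2) xor (toℕ j <ᵇ 2)

IsoTo : Graph 5 → (Fin 5 → Fin 5 → Bool) → Set
IsoTo G r = Σ (Permutation′ 5) λ π → (∀ i j → adj G (π ⟨$⟩ʳ i) (π ⟨$⟩ʳ j) ≡ r i j)

InC5 : Graph 5 → Set
InC5 G = IsoTo G c5adj

InK23 : Graph 5 → Set
InK23 G = IsoTo G k23adj

-- A family H satisfies H ≤ᴴ 𝒟(G) exactly when every member of H dominates G,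
-- since every dominating set contains a minimal one. So U₃ ≤ᴴ 𝒟(G₀) says that
-- every 3-set dominates G₀, and 𝒟(G) ≤ᴴ 𝒟(G₀) says that every minimal dominating
-- set of G dominates G₀. Relabelling G along a permutation π moves 𝒟(G) along π,
-- so for the relabellings of C₅ and K₂,₃ the latter only has to be tested on the
-- images of the five, respectively eight, minimal dominating sets of the model
-- graph. What remains is a finite search, carried out for all graphs on five
-- vertices by evaluating a decision procedure. (G need not be a subgraph of G₀:
-- the bowtie has no spanning C₅ or K₂,₃.)

module Submission where

open import Defs
open import Data.Fin.Subset using (Subset)
open import Data.Product using (∃-syntax; _×_)
open import Data.Sum using (_⊎_)

open import Data.Bool using (Bool; true; false)
import Data.Bool.Properties as Bool
open import Data.Fin using (Fin; zero; suc; toℕ)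
open import Data.Fin.Patterns using (0F; 1F; 2F; 3F; 4F)
open import Data.Fin.Permutation
  using (Permutation′; _⟨$⟩ʳ_; _⟨$⟩ˡ_; inverseˡ; inverseʳ; flip; insert; id)
open import Data.Fin.Properties using (all?; any?)
open import Data.Fin.Subset using (_∈_; _⊆_; _⊂_; ∣_∣; _-_; _∪_; ⁅_⁆)
open import Data.Fin.Subset.Properties
  using (_∈?_; anySubset?; x∈p⇒p-x⊂p; x∈p⇒∣p-x∣<∣p∣; x∈p∧x≢y⇒x∈p-y)
open import Data.List using (List; []; _∷_; [_]; map; concatMap; allFin)
import Data.List.Membership.DecPropositional as ListMembership
open import Data.List.Relation.Unary.All as All using (All)
open import Data.List.Relation.Unary.Any as Any using (Any)
open import Data.Nat using (ℕ; zero; suc; _<_)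
import Data.Nat as ℕ
open import Data.Nat.Induction using (<-wellFounded)
open import Data.Product using (_,_; proj₁)
open import Data.Sum using (inj₁; inj₂)
import Data.Sum as Sum
open import Data.Vec using (lookup; tabulate)
open import Data.Vec.Properties using (lookup∘tabulate; lookup⇒[]=; []=⇒lookup; ≡-dec)
open import Function using (_∘_; _⇔_; mk⇔; Equivalence)
open import Induction.WellFounded using (Acc; acc)
open import Relation.Binary.PropositionalEquality
  using (_≡_; refl; sym; trans; cong₂; subst)
open import Relation.Nullary
  using (Dec; yes; no; ¬_; ¬?; _×-dec_; _⊎-dec_; _→-dec_; map′; decidable-stable; from-yes)
open import Relation.Unary using (Pred; Decidable)

open ListMembership (≡-dec {n = 5} Bool._≟_) using () renaming (_∈_ to _∈ₗ_; _∈?_ to _∈ₗ?_)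

private
  variable
    n : ℕ
    G G′ : Graph n
    A D E : Subset n
    H₁ H₂ H₃ : Family n

⊆ᴴ⇒≤ᴴ : (∀ A → H₁ A → H₂ A) → H₁ ≤ᴴ H₂
⊆ᴴ⇒≤ᴴ H₁⊆H₂ A A∈H₁ = A , H₁⊆H₂ A A∈H₁ , λ x∈A → x∈A

≤ᴴ-trans : H₁ ≤ᴴ H₂ → H₂ ≤ᴴ H₃ → H₁ ≤ᴴ H₃
≤ᴴ-trans H₁≤H₂ H₂≤H₃ A A∈H₁ with H₁≤H₂ A A∈H₁
... | B , B∈H₂ , B⊆A with H₂≤H₃ B B∈H₂
...   | C , C∈H₃ , C⊆B = C , C∈H₃ , B⊆A ∘ C⊆B

allSubsets? : ∀ {ℓ} {P : Pred (Subset n) ℓ} → Decidable P → Dec (∀ A → P A)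
allSubsets? P? = map′
  (λ ¬∃¬P A → decidable-stable (P? A) λ ¬PA → ¬∃¬P (A , ¬PA))
  (λ ∀P (A , ¬PA) → ¬PA (∀P A))
  (¬? (anySubset? (¬? ∘ P?)))

record _≈ᴳ_ (G G′ : Graph n) : Set where
  constructor same-adj
  field
    adj-≡ : ∀ u v → adj G u v ≡ adj G′ u v
open _≈ᴳ_

≈ᴳ-sym : G ≈ᴳ G′ → G′ ≈ᴳ G
≈ᴳ-sym G≈G′ = same-adj λ u v → sym (adj-≡ G≈G′ u v)

Dominating-≈ᴳ : G ≈ᴳ G′ → Dominating G D → Dominating G′ D
Dominating-≈ᴳ G≈G′ dom v v∉D with dom v v∉D
... | u , u∈D , u~v = u , u∈D , trans (sym (adj-≡ G≈G′ u v)) u~v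

Dominating-⊆ : (G : Graph n) → Dominating G D → D ⊆ E → Dominating G E
Dominating-⊆ G dom D⊆E v v∉E with dom v (v∉E ∘ D⊆E)
... | u , u∈D , u~v = u , D⊆E u∈D , u~v

dominating? : (G : Graph n) → Decidable (Dominating G)
dominating? G D = all? λ v → ¬? (v ∈? D) →-dec
  any? λ u → u ∈? D ×-dec adj G u v Bool.≟ true

-- Since domination is upward closed, it suffices to test the sets D - x.
MinDom-by-deletion : (G : Graph n) → Dominating G D →
                     (∀ x → x ∈ D → ¬ Dominating G (D - x)) → MinDom G D
MinDom-by-deletion G dom minimal =
  dom , λ { D′ (D′⊆D , x , x∈D , x∉D′) domD′ → minimal x x∈D
    (Dominating-⊆ G domD′ λ y∈D′ → x∈p∧x≢y⇒x∈p-y (D′⊆D y∈D′)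
      λ { refl → x∉D′ y∈D′ }) }

minDom? : (G : Graph n) → Decidable (MinDom G)
minDom? G D = map′
  (λ (dom , minimal) → MinDom-by-deletion G dom minimal)
  (λ (dom , minimal) → dom , λ x x∈D → minimal (D - x) (x∈p⇒p-x⊂p x∈D))
  (dominating? G D ×-dec all? λ x → x ∈? D →-dec ¬? (dominating? G (D - x)))

Dominating⇒∃MinDom⊆ : (G : Graph n) → Dominating G D → ∃[ B ] (MinDom G B × B ⊆ D)
Dominating⇒∃MinDom⊆ {D = D} G = shrink D (<-wellFounded ∣ D ∣)
  where
  shrink : ∀ D → Acc _<_ ∣ D ∣ → Dominating G D → ∃[ B ] (MinDom G B × B ⊆ D)
  shrink D (acc smaller) dom with any? (λ x → x ∈? D ×-dec dominating? G (D - x))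
  ... | yes (x , x∈D , domD-x) with shrink (D - x) (smaller (x∈p⇒∣p-x∣<∣p∣ x∈D)) domD-x
  ...   | B , minB , B⊆D-x = B , minB , proj₁ (x∈p⇒p-x⊂p x∈D) ∘ B⊆D-x
  shrink D _ dom | no ¬removable =
    D , MinDom-by-deletion G dom (λ x x∈D domD-x → ¬removable (x , x∈D , domD-x)) , λ x∈D → x∈D

≤ᴴ-MinDom⇔Dominating : (G : Graph n) (H : Family n) →
                       H ≤ᴴ MinDom G ⇔ (∀ A → H A → Dominating G A)
≤ᴴ-MinDom⇔Dominating G H = mk⇔
  (λ H≤𝒟 A → contains-MinDom⇒Dominating ∘ H≤𝒟 A)
  (λ dom A → Dominating⇒∃MinDom⊆ G ∘ dom A)
  where
  contains-MinDom⇒Dominating : ∃[ B ] (MinDom G B × B ⊆ A) → Dominating G A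
  contains-MinDom⇒Dominating (B , (domB , _) , B⊆A) = Dominating-⊆ G domB B⊆A

relabel : Permutation′ n → Graph n → Graph n
relabel π G = record
  { adj     = λ i j → adj G (π ⟨$⟩ˡ i) (π ⟨$⟩ˡ j)
  ; adj-sym = λ i j → adj-sym G (π ⟨$⟩ˡ i) (π ⟨$⟩ˡ j)
  ; adj-irr = λ i → adj-irr G (π ⟨$⟩ˡ i)
  }

relabel-IsoTo : (π : Permutation′ 5) (G : Graph 5) → IsoTo (relabel π G) (adj G)
relabel-IsoTo π G = π , λ i j → cong₂ (adj G) (inverseˡ π) (inverseˡ π)

relabel-flip : (π : Permutation′ n) (G : Graph n) → G ≈ᴳ relabel (flip π) (relabel π G)
relabel-flip π G = same-adj λ i j → sym (cong₂ (adj G) (inverseˡ π) (inverseˡ π))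

preimage : Permutation′ n → Subset n → Subset n
preimage π A = tabulate (λ i → lookup A (π ⟨$⟩ʳ i))

image : Permutation′ n → Subset n → Subset n
image π = preimage (flip π)

∈-preimage⁻ : ∀ π {x} → x ∈ preimage π A → π ⟨$⟩ʳ x ∈ A
∈-preimage⁻ {A = A} π {x} x∈ =
  lookup⇒[]= _ A (trans (sym (lookup∘tabulate (lookup A ∘ (π ⟨$⟩ʳ_)) x)) ([]=⇒lookup x∈))

∈-preimage⁺ : ∀ π {x} → π ⟨$⟩ʳ x ∈ A → x ∈ preimage π A
∈-preimage⁺ {A = A} π {x} πx∈A =
  lookup⇒[]= x _ (trans (lookup∘tabulate (lookup A ∘ (π ⟨$⟩ʳ_)) x) ([]=⇒lookup πx∈A))

preimage-mono : ∀ π → A ⊆ E → preimage π A ⊆ preimage π E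
preimage-mono π A⊆E = ∈-preimage⁺ π ∘ A⊆E ∘ ∈-preimage⁻ π

image-preimage-⊆ : ∀ π → image π (preimage π A) ⊆ A
image-preimage-⊆ {A = A} π x∈ =
  subst (_∈ A) (inverseʳ π) (∈-preimage⁻ π (∈-preimage⁻ (flip π) x∈))

Dominating-preimage : (π : Permutation′ n) (G : Graph n) →
                      Dominating (relabel π G) A → Dominating G (preimage π A)
Dominating-preimage {A = A} π G dom v v∉ with dom (π ⟨$⟩ʳ v) (v∉ ∘ ∈-preimage⁺ π)
... | u , u∈A , u~πv =
  π ⟨$⟩ˡ u ,
  ∈-preimage⁺ π (subst (_∈ A) (sym (inverseʳ π)) u∈A) ,
  subst (λ w → adj G (π ⟨$⟩ˡ u) w ≡ true) (inverseˡ π) u~πv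

MinDom-preimage : (π : Permutation′ n) (G : Graph n) →
                  MinDom (relabel π G) A → MinDom G (preimage π A)
MinDom-preimage {A = A} π G (dom , minimal) = Dominating-preimage π G dom , no-smaller-dominating
  where
  no-smaller-dominating : ∀ D′ → D′ ⊂ preimage π A → ¬ Dominating G D′
  no-smaller-dominating D′ (D′⊆ , x , x∈ , x∉D′) domD′ = minimal (image π D′)
    ( image-preimage-⊆ π ∘ preimage-mono (flip π) D′⊆
    , π ⟨$⟩ʳ x
    , ∈-preimage⁻ π x∈
    , λ πx∈ → x∉D′ (subst (_∈ D′) (inverseˡ π) (∈-preimage⁻ (flip π) πx∈)))
    (Dominating-preimage (flip π) (relabel π G) (Dominating-≈ᴳ (relabel-flip π G) domD′))

empty₀ : Graph 0
empty₀ = record { adj = λ () ; adj-sym = λ () ; adj-irr = λ () }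

extend : Subset n → Graph n → Graph (suc n)
extend {n} S G = record { adj = adj′ ; adj-sym = sym′ ; adj-irr = irr′ }
  where
  adj′ : Fin (suc n) → Fin (suc n) → Bool
  adj′ zero    zero    = false
  adj′ zero    (suc j) = lookup S j
  adj′ (suc i) zero    = lookup S i
  adj′ (suc i) (suc j) = adj G i j

  sym′ : ∀ i j → adj′ i j ≡ adj′ j i
  sym′ zero    zero    = refl
  sym′ zero    (suc j) = refl
  sym′ (suc i) zero    = refl
  sym′ (suc i) (suc j) = adj-sym G i j

  irr′ : ∀ i → adj′ i i ≡ false
  irr′ zero    = refl
  irr′ (suc i) = adj-irr G i

delete₀ : Graph (suc n) → Graph n
delete₀ G = record
  { adj     = λ i j → adj G (suc i) (suc j)
  ; adj-sym = λ i j → adj-sym G (suc i) (suc j)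
  ; adj-irr = λ i → adj-irr G (suc i)
  }

neighbours₀ : Graph (suc n) → Subset n
neighbours₀ G = tabulate (adj G zero ∘ suc)

extend-cong : ∀ (S : Subset n) → G ≈ᴳ G′ → extend S G ≈ᴳ extend S G′
extend-cong {n} {G} {G′} S G≈G′ = same-adj same
  where
  same : ∀ u v → adj (extend S G) u v ≡ adj (extend S G′) u v
  same zero    zero    = refl
  same zero    (suc j) = refl
  same (suc i) zero    = refl
  same (suc i) (suc j) = adj-≡ G≈G′ i j

extend-neighbours₀-delete₀ : (G : Graph (suc n)) → extend (neighbours₀ G) (delete₀ G) ≈ᴳ G
extend-neighbours₀-delete₀ G = same-adj same
  where
  same : ∀ u v → adj (extend (neighbours₀ G) (delete₀ G)) u v ≡ adj G u v
  same zero    zero    = sym (adj-irr G zero)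
  same zero    (suc j) = lookup∘tabulate (adj G zero ∘ suc) j
  same (suc i) zero    = trans (lookup∘tabulate (adj G zero ∘ suc) i) (adj-sym G zero (suc i))
  same (suc i) (suc j) = refl

allGraphs? : {P : Graph n → Set} → (∀ {G G′} → G ≈ᴳ G′ → P G → P G′) →
             (∀ G → Dec (P G)) → Dec (∀ G → P G)
allGraphs? {zero} resp P? =
  map′ (λ P∅ G → resp (same-adj λ ()) P∅) (λ ∀P → ∀P empty₀) (P? empty₀)
allGraphs? {suc n} resp P? = map′
  (λ ∀P G → resp (extend-neighbours₀-delete₀ G) (∀P (neighbours₀ G) (delete₀ G)))
  (λ ∀P S G → ∀P (extend S G))
  (allSubsets? λ S → allGraphs? (λ G≈G′ → resp (extend-cong S G≈G′)) (P? ∘ extend S))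

C₅ : Graph 5
C₅ = record
  { adj     = c5adj
  ; adj-sym = λ i j →
      Bool.∨-comm (suc (toℕ i) ℕ.% 5 ℕ.≡ᵇ toℕ j) (suc (toℕ j) ℕ.% 5 ℕ.≡ᵇ toℕ i)
  ; adj-irr = λ { 0F → refl ; 1F → refl ; 2F → refl ; 3F → refl ; 4F → refl }
  }

K₂,₃ : Graph 5
K₂,₃ = record
  { adj     = k23adj
  ; adj-sym = λ i j → Bool.xor-comm (toℕ i ℕ.<ᵇ 2) (toℕ j ℕ.<ᵇ 2)
  ; adj-irr = λ i → Bool.xor-same (toℕ i ℕ.<ᵇ 2)
  }

pair : Fin n → Fin n → Subset n
pair i j = ⁅ i ⁆ ∪ ⁅ j ⁆

minDomC₅ : List (Subset 5)
minDomC₅ = pair 0F 2F ∷ pair 1F 3F ∷ pair 2F 4F ∷ pair 3F 0F ∷ pair 4F 1F ∷ []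

minDomK₂,₃ : List (Subset 5)
minDomK₂,₃ =
  pair 0F 1F ∷ (⁅ 2F ⁆ ∪ pair 3F 4F) ∷
  pair 0F 2F ∷ pair 0F 3F ∷ pair 0F 4F ∷ pair 1F 2F ∷ pair 1F 3F ∷ pair 1F 4F ∷ []

MinDom-C₅ : ∀ A → MinDom C₅ A → A ∈ₗ minDomC₅
MinDom-C₅ = from-yes (allSubsets? λ A → minDom? C₅ A →-dec A ∈ₗ? minDomC₅)

MinDom-K₂,₃ : ∀ A → MinDom K₂,₃ A → A ∈ₗ minDomK₂,₃
MinDom-K₂,₃ = from-yes (allSubsets? λ A → minDom? K₂,₃ A →-dec A ∈ₗ? minDomK₂,₃)

permutations : ∀ n → List (Permutation′ n)
permutations zero    = [ id ]
permutations (suc n) =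
  concatMap (λ j → map (insert zero j) (permutations n)) (allFin (suc n))

ThreeSetsDominate : Graph n → Set
ThreeSetsDominate G = ∀ A → U3 A → Dominating G A

threeSetsDominate? : (G : Graph n) → Dec (ThreeSetsDominate G)
threeSetsDominate? G = allSubsets? λ A → (∣ A ∣ ℕ.≟ 3) →-dec dominating? G A

-- For L ⊇ 𝒟(B), the first component says 𝒟(relabel π B) ≤ᴴ 𝒟(G); see GoodCopy⇒≤ᴴ.
GoodCopy : Graph 5 → List (Subset 5) → Graph 5 → Permutation′ 5 → Set
GoodCopy B L G π = All (Dominating G ∘ image π) L × ThreeSetsDominate (relabel π B)

goodCopy? : ∀ B L G π → Dec (GoodCopy B L G π)
goodCopy? B L G π =
  All.all? (dominating? G ∘ image π) L ×-dec threeSetsDominate? (relabel π B)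

GoodCopy-≈ᴳ : ∀ B L π → G ≈ᴳ G′ → GoodCopy B L G π → GoodCopy B L G′ π
GoodCopy-≈ᴳ B L π G≈G′ (covered , dom) = All.map (Dominating-≈ᴳ G≈G′) covered , dom

HasGoodCopy : Graph 5 → Set
HasGoodCopy G = Any (GoodCopy C₅ minDomC₅ G) (permutations 5)
              ⊎ Any (GoodCopy K₂,₃ minDomK₂,₃ G) (permutations 5)

opaque
  ThreeSetsDominate⇒HasGoodCopy : (G : Graph 5) → ThreeSetsDominate G → HasGoodCopy G
  ThreeSetsDominate⇒HasGoodCopy = from-yes (allGraphs? respects λ G →
    threeSetsDominate? G →-dec
      (Any.any? (goodCopy? C₅ minDomC₅ G) (permutations 5)
        ⊎-dec Any.any? (goodCopy? K₂,₃ minDomK₂,₃ G) (permutations 5)))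
    where
    respects : G ≈ᴳ G′ → (ThreeSetsDominate G → HasGoodCopy G) →
               ThreeSetsDominate G′ → HasGoodCopy G′
    respects G≈G′ copy dom′ =
      Sum.map (Any.map (λ {π} → GoodCopy-≈ᴳ C₅ minDomC₅ π G≈G′))
              (Any.map (λ {π} → GoodCopy-≈ᴳ K₂,₃ minDomK₂,₃ π G≈G′))
        (copy λ A A∈U3 → Dominating-≈ᴳ (≈ᴳ-sym G≈G′) (dom′ A A∈U3))

GoodCopy⇒≤ᴴ : ∀ B L π → (∀ A → MinDom B A → A ∈ₗ L) → GoodCopy B L G π →
              (U3 ≤ᴴ MinDom (relabel π B)) × (MinDom (relabel π B) ≤ᴴ MinDom G)
GoodCopy⇒≤ᴴ {G = G} B L π 𝒟B⊆L (covered , dom) =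
  Equivalence.from (≤ᴴ-MinDom⇔Dominating (relabel π B) U3) dom ,
  Equivalence.from (≤ᴴ-MinDom⇔Dominating G (MinDom (relabel π B))) λ A minA →
    Dominating-⊆ G (All.lookup covered (𝒟B⊆L _ (MinDom-preimage π B minA)))
                   (image-preimage-⊆ π)

DominatedByCopy : Graph 5 → Set
DominatedByCopy G =
  ∃[ G′ ] ((InC5 G′ ⊎ InK23 G′) × (U3 ≤ᴴ MinDom G′) × (MinDom G′ ≤ᴴ MinDom G))

GoodCopy⇒DominatedByCopy : ∀ B L → (∀ G′ → IsoTo G′ (adj B) → InC5 G′ ⊎ InK23 G′) →
                           (∀ A → MinDom B A → A ∈ₗ L) →
                           ∃[ π ] GoodCopy B L G π → DominatedByCopy G
GoodCopy⇒DominatedByCopy {G = G} B L shape 𝒟B⊆L (π , good) =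
  relabel π B , shape (relabel π B) (relabel-IsoTo π B) , GoodCopy⇒≤ᴴ {G = G} B L π 𝒟B⊆L good

HasGoodCopy⇒DominatedByCopy : HasGoodCopy G → DominatedByCopy G
HasGoodCopy⇒DominatedByCopy {G = G} (inj₁ copies) =
  GoodCopy⇒DominatedByCopy {G = G} C₅ minDomC₅ (λ _ → inj₁) MinDom-C₅ (Any.satisfied copies)
HasGoodCopy⇒DominatedByCopy {G = G} (inj₂ copies) =
  GoodCopy⇒DominatedByCopy {G = G} K₂,₃ minDomK₂,₃ (λ _ → inj₂) MinDom-K₂,₃ (Any.satisfied copies)

proposition4p19 : (H : Subset 5 → Set) → IsDominationCompletionU3 H →
    ∃[ G ] ((InC5 G ⊎ InK23 G) × (U3 ≤ᴴ MinDom G) × (MinDom G ≤ᴴ H))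
proposition4p19 H ((G₀ , H⇔𝒟G₀) , _ , U3≤H) =
  conclude (HasGoodCopy⇒DominatedByCopy {G = G₀} (ThreeSetsDominate⇒HasGoodCopy G₀ threeSetsDominate))
  where
  U3≤𝒟G₀ : U3 ≤ᴴ MinDom G₀
  U3≤𝒟G₀ = ≤ᴴ-trans U3≤H (⊆ᴴ⇒≤ᴴ λ A → Equivalence.to (H⇔𝒟G₀ A))

  threeSetsDominate : ThreeSetsDominate G₀
  threeSetsDominate = Equivalence.to (≤ᴴ-MinDom⇔Dominating G₀ U3) U3≤𝒟G₀

  conclude : DominatedByCopy G₀ → ∃[ G ] ((InC5 G ⊎ InK23 G) × (U3 ≤ᴴ MinDom G) × (MinDom G ≤ᴴ H))
  conclude (G , shape , U3≤𝒟G , 𝒟G≤𝒟G₀) =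
    G , shape , U3≤𝒟G , ≤ᴴ-trans 𝒟G≤𝒟G₀ (⊆ᴴ⇒≤ᴴ λ A → Equivalence.from (H⇔𝒟G₀ A))
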